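{- Every convergent Chip Firing Game on a mutating graph (MCFG) is equivalent to a Chip Firing Game (CFG), that is, there is a convergent CFG whose configuration space is isomorphic, as a poset, to that of the given MCFG.
   Context: A Chip Firing Game (CFG) is played on a finite directed multigraph with an initial distribution of chips $\sigma_0:V\to\mathbb{N}$. A vertex $v$ with at least one outgoing edge and at least $d^+(v)$ chips (its outdegree) may be fired, which sends one chip along each outgoing edge. An MCFG is the same game, except that the graph changes during play. Each vertex $v$ carries an infinite sequence $M_v=(E_1(v),E_2(v),\ldots)$ of finite multisets of vertices. After $v$ is fired, its outgoing edges are removed, an edge $(v,w)$ is created for each occurrence of $w$ in $E_1(v)$, and $E_1(v)$ is removed from $M_v$. For either game, the configuration space is the set of configurations reachable from the initial one, ordered by reachability. A game is convergent if it reaches a final configuration in which no firing is possible. Two convergent games are equivalent if their configuration spaces are isomorphic posets. -}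

module Defs where

open import Data.Nat using (ℕ; zero; suc; _+_; _∸_; _≤_)
open import Data.Fin using (Fin; zero; suc; _≟_)
open import Data.Bool using (if_then_else_)
open import Data.Product using (Σ; ∃; _×_; _,_)
open import Relation.Nullary using (¬_)
open import Relation.Nullary.Decidable using (⌊_⌋)
open import Relation.Binary.PropositionalEquality using (_≡_)
open import Relation.Binary.Construct.Closure.ReflexiveTransitive using (Star)
open import Function.Bundles using (_⇔_)

-- A directed multigraph assigns to each vertex v
-- the multiset of heads of its outgoing edges (loops allowed).

Multiset : ℕ → Set
Multiset n = Fin n → ℕ

Graph : ℕ → Set
Graph n = Fin n → Multiset n

Config : ℕ → Set
Config n = Fin n → ℕ

sumFin : ∀ {n} → (Fin n → ℕ) → ℕ
sumFin {zero}  f = 0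
sumFin {suc n} f = f zero + sumFin (λ i → f (suc i))

outdeg : ∀ {n} → Multiset n → ℕ
outdeg E = sumFin E

Firable : ∀ {n} → Multiset n → Config n → Fin n → Set
Firable E σ v = (1 ≤ outdeg E) × (outdeg E ≤ σ v)

fire : ∀ {n} → Multiset n → Fin n → Config n → Config n
fire E v σ w = (if ⌊ v ≟ w ⌋ then σ w ∸ outdeg E else σ w) + E w

record Game : Set₁ where
  field
    State : Set
    _≈_   : State → State → Set
    _⟶_   : State → State → Set
    init  : State

module _ (g : Game) where
  open Game g

  _⊑_ : State → State → Set
  x ⊑ y = ∃ λ z → Star _⟶_ x z × z ≈ y

  Reachable : State → Set
  Reachable x = init ⊑ x

record ConfigSpaceIso (g h : Game) : Set where
  private
    module G = Game g
    module H = Game h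
  field
    f       : (x : G.State) → Reachable g x → H.State
    f-reach : ∀ x p → Reachable h (f x p)
    f-eq    : ∀ x p y q → (G._≈_ x y ⇔ H._≈_ (f x p) (f y q))
    f-surj  : ∀ y → Reachable h y → ∃ λ x → Σ (Reachable g x) λ p → H._≈_ (f x p) y
    f-order : ∀ x p y q → (_⊑_ g x y ⇔ _⊑_ h (f x p) (f y q))

record CFG : Set where
  field
    n  : ℕ
    G  : Graph n
    σ₀ : Config n

module _ (c : CFG) where
  open CFG c

  CFGStep : Config n → Config n → Set
  CFGStep σ σ' = ∃ λ v → Firable (G v) σ v × (∀ w → σ' w ≡ fire (G v) v σ w)

  cfgGame : Game
  cfgGame = record
    { State = Config n
    ; _≈_   = λ σ τ → ∀ w → σ w ≡ τ w
    ; _⟶_   = CFGStep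
    ; init  = σ₀
    }

  CFGConvergent : Set
  CFGConvergent = ∃ λ σ → Reachable cfgGame σ × (∀ v → ¬ Firable (G v) σ v)

-- M v i = E_{i+1}(v) (the (i+1)-th multiset of the sequence M_v).
-- A state records the chips and the number of times each vertex has been
-- fired; the current out-edges of v and the remaining sequence M_v are
-- determined by that number.

record MCFG : Set where
  field
    n  : ℕ
    G₀ : Graph n
    M  : Fin n → ℕ → Multiset n
    σ₀ : Config n

module _ (m : MCFG) where
  open MCFG m

  curEdges : Fin n → ℕ → Multiset n
  curEdges v zero    = G₀ v
  curEdges v (suc c) = M v c

  MState : Set
  MState = Config n × (Fin n → ℕ)

  MSame : MState → MState → Set
  MSame (σ , k) (σ' , k') =
    (∀ w → σ w ≡ σ' w) ×
    (∀ v w → curEdges v (k v) w ≡ curEdges v (k' v) w) ×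
    (∀ v i w → M v (k v + i) w ≡ M v (k' v + i) w)

  fireM : Fin n → MState → MState
  fireM v (σ , k) =
    fire (curEdges v (k v)) v σ ,
    (λ w → if ⌊ v ≟ w ⌋ then suc (k w) else k w)

  MFirable : MState → Fin n → Set
  MFirable (σ , k) v = Firable (curEdges v (k v)) σ v

  MCFGStep : MState → MState → Set
  MCFGStep s s' = ∃ λ v → MFirable s v × MSame s' (fireM v s)

  mcfgGame : Game
  mcfgGame = record
    { State = MState
    ; _≈_   = MSame
    ; _⟶_   = MCFGStep
    ; init  = (σ₀ , λ _ → 0)
    }

  MCFGConvergent : Set
  MCFGConvergent = ∃ λ s → Reachable mcfgGame s × (∀ v → ¬ MFirable s v)

-- An MCFG play is governed by its firing vector κ, the number of times each vertex
-- has fired: the chips are the initial ones plus what was received minus what was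
-- spent, and the current edges and remaining sequences are those of M_v after κ v
-- firings.  By the exchange property of chip firing, the reachable firing vectors
-- ordered pointwise model the configuration space, faithfully so once the game
-- converges, since every reachable vector then lies below the final one N.
-- The simulating CFG gives each vertex u a chain with one vertex per firing of u
-- (N u of them), each receiving a copy of every chip sent to u.  A bonus exceeding
-- any reachable inflow is handed along the chain, so only the chain vertex of u's
-- next firing can fire, and it can exactly when u can.  Counters record κ and a sink
-- absorbs the bonus and the spent chips, so the CFG is modelled by the same vectors.
module Submission where

open import Defs
open import Data.Bool using (true; false; if_then_else_)
open import Data.Empty using (⊥-elim)
open import Data.Fin using (Fin; zero; suc; _≟_; toℕ; fromℕ<; combine; remQuot)
import Data.Fin.Properties as Fin
open import Data.List using (List; []; _∷_)
open import Data.Nat using (ℕ; zero; suc; _+_; _∸_; _*_; _≤_; _<_; z≤n; s≤s; _<?_)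
import Data.Nat as ℕ
open import Data.Nat.Properties hiding (_≟_)
open import Data.Nat.Tactic.RingSolver using (solve-∀)
open import Data.Product using (Σ; ∃; _×_; _,_; proj₁; proj₂)
open import Data.Sum using (_⊎_; inj₁; inj₂)
open import Data.Unit using (⊤; tt)
open import Function using (_∘_)
open import Function.Bundles using (_⇔_; mk⇔)
open import Function.Properties.Equivalence using (⇔-isEquivalence)
open import Relation.Binary.Definitions using (tri<; tri≈; tri>)
open import Relation.Binary.PropositionalEquality
open import Relation.Binary.Construct.Closure.ReflexiveTransitive using (Star; ε; _◅_)
open import Relation.Binary.Bundles using (Setoid)
open import Relation.Binary.Structures using (IsEquivalence)
open import Relation.Nullary using (¬_; Dec; yes; no)
open import Relation.Nullary.Decidable using (⌊_⌋)

sumFin-cong : ∀ {n} {f g : Fin n → ℕ} → f ≗ g → sumFin f ≡ sumFin g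
sumFin-cong {zero}  f≗g = refl
sumFin-cong {suc n} f≗g = cong₂ _+_ (f≗g zero) (sumFin-cong (f≗g ∘ suc))

sumFin-mono : ∀ {n} {f g : Fin n → ℕ} → (∀ i → f i ≤ g i) → sumFin f ≤ sumFin g
sumFin-mono {zero}  f≤g = z≤n
sumFin-mono {suc n} f≤g = +-mono-≤ (f≤g zero) (sumFin-mono (λ i → f≤g (suc i)))

sumFin-zero : ∀ {n} {f : Fin n → ℕ} → (∀ i → f i ≡ 0) → sumFin f ≡ 0
sumFin-zero {zero}  f≡0 = refl
sumFin-zero {suc n} f≡0 = cong₂ _+_ (f≡0 zero) (sumFin-zero (λ i → f≡0 (suc i)))

≤-sumFin : ∀ {n} (f : Fin n → ℕ) i → f i ≤ sumFin f
≤-sumFin f zero    = m≤m+n _ _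
≤-sumFin f (suc i) = ≤-trans (≤-sumFin (λ j → f (suc j)) i) (m≤n+m _ (f zero))

sumFin-increase : ∀ {n} {f g : Fin n → ℕ} v x →
                  (∀ w → v ≢ w → g w ≡ f w) → g v ≡ f v + x → sumFin g ≡ sumFin f + x
sumFin-increase {f = f} {g} zero x g≡f gv≡fv+x =
  trans (cong₂ _+_ gv≡fv+x (sumFin-cong (λ i → g≡f (suc i) (λ ())))) (swap-last (f zero) x (sumFin (f ∘ suc)))
  where
  swap-last : ∀ a b c → a + b + c ≡ a + c + b
  swap-last = solve-∀
sumFin-increase {f = f} {g} (suc v) x g≡f gv≡fv+x = begin
  g zero + sumFin (g ∘ suc)       ≡⟨ cong₂ _+_ (g≡f zero (λ ())) tail ⟩
  f zero + (sumFin (f ∘ suc) + x) ≡⟨ +-assoc (f zero) _ x ⟨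
  f zero + sumFin (f ∘ suc) + x   ∎
  where
  open ≡-Reasoning
  tail : sumFin (g ∘ suc) ≡ sumFin (f ∘ suc) + x
  tail = sumFin-increase v x (λ w v≢w → g≡f (suc w) (v≢w ∘ Fin.suc-injective)) gv≡fv+x

fire-cong : ∀ {n} {E E' : Multiset n} {σ σ' : Config n} v → E ≗ E' → σ ≗ σ' → fire E v σ ≗ fire E' v σ'
fire-cong v E≗E' σ≗σ' w with ⌊ v ≟ w ⌋
... | true  = cong₂ _+_ (cong₂ _∸_ (σ≗σ' w) (sumFin-cong E≗E')) (E≗E' w)
... | false = cong₂ _+_ (σ≗σ' w) (E≗E' w)

Firable-resp : ∀ {n} {E : Multiset n} {σ σ' : Config n} {v} → σ ≗ σ' → Firable E σ v → Firable E σ' v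
Firable-resp {E = E} {v = v} σ≗σ' (positive , enough) = positive , subst (outdeg E ≤_) (σ≗σ' v) enough

fire-self : ∀ {n} (E : Multiset n) v σ → fire E v σ v ≡ (σ v ∸ outdeg E) + E v
fire-self E v σ with v ≟ v
... | yes _   = refl
... | no v≢v = ⊥-elim (v≢v refl)

fire-other : ∀ {n} (E : Multiset n) {v w} σ → v ≢ w → fire E v σ w ≡ σ w + E w
fire-other E {v} {w} σ v≢w with v ≟ w
... | yes v≡w = ⊥-elim (v≢w v≡w)
... | no _    = refl

prefixSum : (ℕ → ℕ) → ℕ → ℕ
prefixSum f zero    = 0
prefixSum f (suc c) = prefixSum f c + f c

prefixSum-mono : ∀ f {c c'} → c ≤ c' → prefixSum f c ≤ prefixSum f c'
prefixSum-mono f {c' = zero}   z≤n    = ≤-refl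
prefixSum-mono f {c' = suc c'} c≤1+c' with m≤n⇒m<n∨m≡n c≤1+c'
... | inj₁ (s≤s c≤c') = ≤-trans (prefixSum-mono f c≤c') (m≤m+n _ (f c'))
... | inj₂ refl       = ≤-refl

byComparison : (a b lt eq gt : ℕ) → ℕ
byComparison zero    zero    lt eq gt = eq
byComparison zero    (suc b) lt eq gt = lt
byComparison (suc a) zero    lt eq gt = gt
byComparison (suc a) (suc b) lt eq gt = byComparison a b lt eq gt

module _ {lt eq gt : ℕ} where

  byComparison-< : ∀ {a b} → a < b → byComparison a b lt eq gt ≡ lt
  byComparison-< {zero}  {suc b} _         = refl
  byComparison-< {suc a} {suc b} (s≤s a<b) = byComparison-< a<b

  byComparison-≡ : ∀ {a b} → a ≡ b → byComparison a b lt eq gt ≡ eq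
  byComparison-≡ {zero}  refl = refl
  byComparison-≡ {suc a} refl = byComparison-≡ {a} refl

  byComparison-> : ∀ {a b} → b < a → byComparison a b lt eq gt ≡ gt
  byComparison-> {suc a} {zero}  _         = refl
  byComparison-> {suc a} {suc b} (s≤s b<a) = byComparison-> b<a

-- The chain vertex of the (level+1)-th firing of u, once u has fired c times and received
-- i chips in total: it waits with pad + i (pad funds its edges to non-sink vertices), is
-- armed with the bonus at its turn, and afterwards keeps i ∸ cost, where cost is what u
-- has spent after that firing.  Hence at its turn it can fire exactly when cost ≤ i.
module ChainVertex (level pad bonus cost : ℕ) where

  chips : (fired inflow : ℕ) → ℕ
  chips c i = byComparison c level (pad + i) (bonus + pad + i) (i ∸ cost)

  outdegree : ℕ
  outdegree = bonus + cost + pad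

  private
    outdegree≡ : outdegree ≡ bonus + pad + cost
    outdegree≡ = swap-last bonus cost pad
      where
      swap-last : ∀ a b c → a + b + c ≡ a + c + b
      swap-last = solve-∀

  chips-receive : ∀ {c i} x → (level < c → cost ≤ i) → chips c i + x ≡ chips c (i + x)
  chips-receive {c} {i} x paid with <-cmp c level
  ... | tri< c<l _ _ = trans (cong (_+ x) (byComparison-< c<l)) (trans (+-assoc pad i x) (sym (byComparison-< c<l)))
  ... | tri≈ _ c≡l _ = trans (cong (_+ x) (byComparison-≡ c≡l))
                         (trans (+-assoc (bonus + pad) i x) (sym (byComparison-≡ c≡l)))
  ... | tri> _ _ l<c = trans (cong (_+ x) (byComparison-> l<c)) (trans (sym (+-∸-comm x (paid l<c))) (sym (byComparison-> l<c)))

  chips-skip : ∀ {c i} → c ≢ level → suc c ≢ level → chips (suc c) i ≡ chips c i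
  chips-skip {c} c≢l 1+c≢l with <-cmp c level
  ... | tri< c<l _ _ = trans (byComparison-< (≤∧≢⇒< c<l 1+c≢l)) (sym (byComparison-< c<l))
  ... | tri≈ _ c≡l _ = ⊥-elim (c≢l c≡l)
  ... | tri> _ _ l<c = trans (byComparison-> (m<n⇒m<1+n l<c)) (sym (byComparison-> l<c))

  chips-handover : ∀ {c i} x → suc c ≡ level → chips c i + (x + bonus) ≡ chips (suc c) (i + x)
  chips-handover {c} {i} x 1+c≡l = begin
    chips c i + (x + bonus)   ≡⟨ cong (_+ (x + bonus)) (byComparison-< (≤-reflexive 1+c≡l)) ⟩
    pad + i + (x + bonus)     ≡⟨ shuffle pad i x bonus ⟩
    bonus + pad + (i + x)     ≡⟨ byComparison-≡ 1+c≡l ⟨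
    chips (suc c) (i + x)     ∎
    where
    open ≡-Reasoning
    shuffle : ∀ p i x b → p + i + (x + b) ≡ b + p + (i + x)
    shuffle = solve-∀

  chips-fire : ∀ {c i} x → c ≡ level → cost ≤ i → (chips c i ∸ outdegree) + x ≡ chips (suc c) (i + x)
  chips-fire {c} {i} x c≡l paid = begin
    (chips c i ∸ outdegree) + x                       ≡⟨ cong₂ (λ a b → (a ∸ b) + x) (byComparison-≡ c≡l) outdegree≡ ⟩
    (bonus + pad + i ∸ (bonus + pad + cost)) + x      ≡⟨ cong (_+ x) ([m+n]∸[m+o]≡n∸o (bonus + pad) i cost) ⟩
    (i ∸ cost) + x                                    ≡⟨ +-∸-comm x paid ⟨
    (i + x) ∸ cost                                    ≡⟨ byComparison-> (s≤s (≤-reflexive (sym c≡l))) ⟨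
    chips (suc c) (i + x)                             ∎
    where open ≡-Reasoning

  firable-at-level : ∀ {c i} → c ≡ level → cost ≤ i → outdegree ≤ chips c i
  firable-at-level c≡l paid =
    subst₂ _≤_ (sym outdegree≡) (sym (byComparison-≡ c≡l)) (+-monoʳ-≤ (bonus + pad) paid)

  firable⇒at-level : ∀ c {i} → i < bonus → outdegree ≤ chips c i → c ≡ level × cost ≤ i
  firable⇒at-level c {i} i<bonus fires with <-cmp c level
  ... | tri< c<l _ _ = ⊥-elim (<⇒≱ i<bonus (≤-trans (m≤m+n bonus cost) (+-cancelʳ-≤ pad (bonus + cost) i
                          (subst (outdegree ≤_) (trans (byComparison-< c<l) (+-comm pad i)) fires))))
  ... | tri≈ _ c≡l _ = c≡l , +-cancelˡ-≤ (bonus + pad) cost i (subst₂ _≤_ outdegree≡ (byComparison-≡ c≡l) fires)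
  ... | tri> _ _ l<c = ⊥-elim (<⇒≱ i<bonus (≤-trans bonus≤outdegree (≤-trans fires chips≤i)))
    where
    bonus≤outdegree : bonus ≤ outdegree
    bonus≤outdegree = ≤-trans (m≤m+n bonus cost) (m≤m+n (bonus + cost) pad)
    chips≤i : chips c i ≤ i
    chips≤i = subst (_≤ i) (sym (byComparison-> l<c)) (m∸n≤m i cost)

module MCFGProperties (m : MCFG) where
  open MCFG m

  MSame-isEquivalence : IsEquivalence (MSame m)
  MSame-isEquivalence = record
    { refl  = λ { {σ , k} → (λ _ → refl) , (λ _ _ → refl) , (λ _ _ _ → refl) }
    ; sym   = λ { {σ , k} {σ' , k'} (c , e , f) → (sym ∘ c) , (λ v w → sym (e v w)) , (λ v i w → sym (f v i w)) }
    ; trans = λ { {σ , k} {σ' , k'} {σ'' , k''} (c , e , f) (c' , e' , f') →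
                  (λ w → trans (c w) (c' w)) , (λ v w → trans (e v w) (e' v w)) , (λ v i w → trans (f v i w) (f' v i w)) }
    }

  MFirable-resp : ∀ {x y} v → MSame m x y → MFirable m x v → MFirable m y v
  MFirable-resp {σ , k} {σ' , k'} v (chips≗ , edges≗ , _) (positive , enough) =
    subst (1 ≤_) (sumFin-cong (edges≗ v)) positive ,
    subst₂ _≤_ (sumFin-cong (edges≗ v)) (chips≗ v) enough

  fireM-resp : ∀ {x y} v → MSame m x y → MSame m (fireM m v x) (fireM m v y)
  fireM-resp {σ , k} {σ' , k'} v (chips≗ , edges≗ , future≗) =
    fire-cong v (edges≗ v) chips≗ , edges⁺≗ , future⁺≗
    where
    k⁺ k'⁺ : Fin n → ℕ
    k⁺  = proj₂ (fireM m v (σ , k))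
    k'⁺ = proj₂ (fireM m v (σ' , k'))

    edges⁺≗ : ∀ u w → curEdges m u (k⁺ u) w ≡ curEdges m u (k'⁺ u) w
    edges⁺≗ u w with v ≟ u
    ... | yes refl = subst₂ (λ a b → M v a w ≡ M v b w) (+-identityʳ (k v)) (+-identityʳ (k' v)) (future≗ v 0 w)
    ... | no _     = edges≗ u w

    future⁺≗ : ∀ u i w → M u (k⁺ u + i) w ≡ M u (k'⁺ u + i) w
    future⁺≗ u i w with v ≟ u
    ... | yes refl = subst₂ (λ a b → M v a w ≡ M v b w) (+-suc (k v) i) (+-suc (k' v) i) (future≗ v (suc i) w)
    ... | no _     = future≗ u i w

module FiringVectors (m : MCFG) where
  open MCFG m
  open MCFGProperties m

  FiringVector : Set
  FiringVector = Fin n → ℕ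

  zeros : FiringVector
  zeros _ = 0

  _≤v_ : FiringVector → FiringVector → Set
  κ ≤v κ' = ∀ w → κ w ≤ κ' w

  fireAt : Fin n → FiringVector → FiringVector
  fireAt v κ w = if ⌊ v ≟ w ⌋ then suc (κ w) else κ w

  edges : Fin n → ℕ → Multiset n
  edges = curEdges m

  degree : Fin n → ℕ → ℕ
  degree v c = outdeg (edges v c)

  spent : Fin n → ℕ → ℕ
  spent v = prefixSum (degree v)

  sent : Fin n → ℕ → Multiset n
  sent v c w = prefixSum (λ t → edges v t w) c

  inflow : FiringVector → Fin n → ℕ
  inflow κ u = σ₀ u + sumFin (λ v → sent v (κ v) u)

  state : FiringVector → MState m
  state κ = (λ u → inflow κ u ∸ spent u (κ u)) , κ

  CanFire : FiringVector → Fin n → Set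
  CanFire κ v = 1 ≤ degree v (κ v) × spent v (suc (κ v)) ≤ inflow κ v

  fireAt-self : ∀ v κ → fireAt v κ v ≡ suc (κ v)
  fireAt-self v κ with v ≟ v
  ... | yes _   = refl
  ... | no v≢v = ⊥-elim (v≢v refl)

  fireAt-other : ∀ {v w} κ → v ≢ w → fireAt v κ w ≡ κ w
  fireAt-other {v} {w} κ v≢w with v ≟ w
  ... | yes v≡w = ⊥-elim (v≢w v≡w)
  ... | no _    = refl

  ≤v-fireAt : ∀ v κ → κ ≤v fireAt v κ
  ≤v-fireAt v κ w with v ≟ w
  ... | yes _ = n≤1+n (κ w)
  ... | no _  = ≤-refl

  fireAt-reflects-≤v : ∀ {κ κ'} v → fireAt v κ ≤v fireAt v κ' → κ ≤v κ'
  fireAt-reflects-≤v v le w with v ≟ w | le w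
  ... | yes _ | s≤s κw≤κ'w = κw≤κ'w
  ... | no _  | κw≤κ'w     = κw≤κ'w

  fireAt-≤v : ∀ {κ κ'} v → κ ≤v κ' → κ v < κ' v → fireAt v κ ≤v κ'
  fireAt-≤v v le κv<κ'v w with v ≟ w
  ... | yes refl = κv<κ'v
  ... | no _     = le w

  sumFin-fireAt : ∀ v κ → sumFin (fireAt v κ) ≡ sumFin κ + 1
  sumFin-fireAt v κ = sumFin-increase v 1 (λ w → fireAt-other κ) (trans (fireAt-self v κ) (+-comm 1 (κ v)))

  inflow-mono : ∀ {κ κ'} u → κ ≤v κ' → inflow κ u ≤ inflow κ' u
  inflow-mono u le = +-monoʳ-≤ (σ₀ u) (sumFin-mono (λ v → prefixSum-mono (λ t → edges v t u) (le v)))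

  inflow-cong : ∀ {κ κ'} u → κ ≗ κ' → inflow κ u ≡ inflow κ' u
  inflow-cong u κ≗κ' = cong (σ₀ u +_) (sumFin-cong (λ v → cong (λ c → sent v c u) (κ≗κ' v)))

  inflow-zeros : ∀ u → inflow zeros u ≡ σ₀ u
  inflow-zeros u = trans (cong (σ₀ u +_) (sumFin-zero {f = λ v → sent v (zeros v) u} (λ _ → refl))) (+-identityʳ (σ₀ u))

  inflow-fireAt : ∀ v κ u → inflow (fireAt v κ) u ≡ inflow κ u + edges v (κ v) u
  inflow-fireAt v κ u = begin
    σ₀ u + sumFin (λ w → sent w (fireAt v κ w) u)          ≡⟨ cong (σ₀ u +_) sent-increase ⟩
    σ₀ u + (sumFin (λ w → sent w (κ w) u) + edges v (κ v) u) ≡⟨ +-assoc (σ₀ u) _ _ ⟨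
    inflow κ u + edges v (κ v) u                           ∎
    where
    open ≡-Reasoning
    sent-increase : sumFin (λ w → sent w (fireAt v κ w) u) ≡ sumFin (λ w → sent w (κ w) u) + edges v (κ v) u
    sent-increase = sumFin-increase v _ (λ w v≢w → cong (λ c → sent w c u) (fireAt-other κ v≢w))
                                        (cong (λ c → sent v c u) (fireAt-self v κ))

  state-cong : ∀ {κ κ'} → κ ≗ κ' → MSame m (state κ) (state κ')
  state-cong κ≗κ' = (λ u → cong₂ _∸_ (inflow-cong u κ≗κ') (cong (spent u) (κ≗κ' u))) ,
                    (λ v w → cong (λ c → edges v c w) (κ≗κ' v)) ,
                    (λ v i w → cong (λ c → M v (c + i) w) (κ≗κ' v))

  Solvent : FiringVector → Set
  Solvent κ = ∀ u → spent u (κ u) ≤ inflow κ u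

  CanFire⇒MFirable : ∀ {κ} v → CanFire κ v → MFirable m (state κ) v
  CanFire⇒MFirable {κ} v (positive , paid) =
    positive , m+n≤o⇒m≤o∸n (degree v (κ v)) (subst (_≤ inflow κ v) (+-comm (spent v (κ v)) _) paid)

  MFirable⇒CanFire : ∀ {κ} v → Solvent κ → MFirable m (state κ) v → CanFire κ v
  MFirable⇒CanFire {κ} v solvent (positive , enough) =
    positive , subst (_≤ inflow κ v) (+-comm (degree v (κ v)) _) (m≤o∸n⇒m+n≤o _ (solvent v) enough)

  fireM-state : ∀ {κ} v → Solvent κ → CanFire κ v → MSame m (fireM m v (state κ)) (state (fireAt v κ))
  fireM-state {κ} v solvent (_ , paid) = chips≗ , (λ _ _ → refl) , (λ _ _ _ → refl)
    where
    open ≡-Reasoning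
    chips≗ : ∀ w → fire (edges v (κ v)) v (proj₁ (state κ)) w ≡ inflow (fireAt v κ) w ∸ spent w (fireAt v κ w)
    chips≗ w with v ≟ w
    ... | yes refl = begin
      (inflow κ v ∸ spent v (κ v)) ∸ degree v (κ v) + edges v (κ v) v
        ≡⟨ cong (_+ edges v (κ v) v) (∸-+-assoc (inflow κ v) (spent v (κ v)) (degree v (κ v))) ⟩
      (inflow κ v ∸ spent v (suc (κ v))) + edges v (κ v) v
        ≡⟨ +-∸-comm _ paid ⟨
      (inflow κ v + edges v (κ v) v) ∸ spent v (suc (κ v))
        ≡⟨ cong (_∸ spent v (suc (κ v))) (inflow-fireAt v κ v) ⟨
      inflow (fireAt v κ) v ∸ spent v (suc (κ v))
        ∎
    ... | no _ = begin
      (inflow κ w ∸ spent w (κ w)) + edges v (κ v) w ≡⟨ +-∸-comm _ (solvent w) ⟨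
      (inflow κ w + edges v (κ v) w) ∸ spent w (κ w) ≡⟨ cong (_∸ spent w (κ w)) (inflow-fireAt v κ w) ⟨
      inflow (fireAt v κ) w ∸ spent w (κ w)          ∎

  data Reach : FiringVector → Set where
    reach-zeros : Reach zeros
    reach-fire  : ∀ {κ} v → Reach κ → CanFire κ v → Reach (fireAt v κ)

  Reach⇒Solvent : ∀ {κ} → Reach κ → Solvent κ
  Reach⇒Solvent reach-zeros u = z≤n
  Reach⇒Solvent (reach-fire {κ} v r (_ , paid)) u with v ≟ u
  ... | yes refl = ≤-trans paid (inflow-mono v (≤v-fireAt v κ))
  ... | no _     = ≤-trans (Reach⇒Solvent r u) (inflow-mono u (≤v-fireAt v κ))

  Reach⇒degree-positive : ∀ {κ} → Reach κ → ∀ u {c} → c < κ u → 1 ≤ degree u c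
  Reach⇒degree-positive (reach-fire {κ} v r (positive , _)) u {c} c<κ'u with v ≟ u
  ... | no _     = Reach⇒degree-positive r u c<κ'u
  ... | yes refl with m≤n⇒m<n∨m≡n (≤-pred c<κ'u)
  ...   | inj₁ c<κv = Reach⇒degree-positive r v c<κv
  ...   | inj₂ refl = positive

  CanFire-mono : ∀ {κ κ'} v → κ ≤v κ' → κ v ≡ κ' v → CanFire κ v → CanFire κ' v
  CanFire-mono {κ} {κ'} v κ≤κ' κv≡κ'v (positive , paid) =
    subst (λ c → 1 ≤ degree v c) κv≡κ'v positive ,
    subst (λ c → spent v (suc c) ≤ inflow κ' v) κv≡κ'v (≤-trans paid (inflow-mono v κ≤κ'))

  -- Exchange property: the first firing in the history of μ that κ has not matched is still available to κ.
  Reach⇒≤v⊎CanFire : ∀ {μ} → Reach μ → ∀ κ → μ ≤v κ ⊎ ∃ λ v → κ v < μ v × CanFire κ v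
  Reach⇒≤v⊎CanFire reach-zeros κ = inj₁ (λ _ → z≤n)
  Reach⇒≤v⊎CanFire (reach-fire {μ} v r F) κ with Reach⇒≤v⊎CanFire r κ
  ... | inj₂ (u , κu<μu , Fu) = inj₂ (u , <-≤-trans κu<μu (≤v-fireAt v μ u) , Fu)
  ... | inj₁ μ≤κ with m≤n⇒m<n∨m≡n (μ≤κ v)
  ...   | inj₁ μv<κv = inj₁ (fireAt-≤v v μ≤κ μv<κv)
  ...   | inj₂ μv≡κv = inj₂ (v , subst (κ v <_) (sym (fireAt-self v μ)) (s≤s (≤-reflexive (sym μv≡κv))) ,
                             CanFire-mono v μ≤κ μv≡κv F)

  run : FiringVector → List (Fin n) → FiringVector
  run κ []       = κ
  run κ (v ∷ vs) = run (fireAt v κ) vs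

  Legal : FiringVector → List (Fin n) → Set
  Legal κ []       = ⊤
  Legal κ (v ∷ vs) = CanFire κ v × Legal (fireAt v κ) vs

  Legal⇒Reach : ∀ {κ} vs → Reach κ → Legal κ vs → Reach (run κ vs)
  Legal⇒Reach []       r _            = r
  Legal⇒Reach (v ∷ vs) r (F , legal) = Legal⇒Reach vs (reach-fire v r F) legal

  run-reflects-≤v : ∀ {κ κ'} vs → run κ vs ≤v run κ' vs → κ ≤v κ'
  run-reflects-≤v []       le = le
  run-reflects-≤v (v ∷ vs) le = fireAt-reflects-≤v v (run-reflects-≤v vs le)

  legal-run-between : ∀ {κ κ'} → Reach κ → Reach κ' → κ ≤v κ' → ∃ λ vs → Legal κ vs × run κ vs ≗ κ'
  legal-run-between {κ} {κ'} r r' κ≤κ' = go (sumFin κ' ∸ sumFin κ) r κ≤κ' (m+[n∸m]≡n (sumFin-mono κ≤κ'))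
    where
    go : ∀ {κ} gap → Reach κ → κ ≤v κ' → sumFin κ + gap ≡ sumFin κ' →
         ∃ λ vs → Legal κ vs × run κ vs ≗ κ'
    go {κ} gap r κ≤κ' total with Reach⇒≤v⊎CanFire r' κ
    ... | inj₁ κ'≤κ = [] , tt , λ w → ≤-antisym (κ≤κ' w) (κ'≤κ w)
    ... | inj₂ (v , κv<κ'v , F) with gap
    ...   | zero = ⊥-elim (n≮0 (+-cancelˡ-≤ (sumFin κ) 1 0
                       (subst₂ _≤_ (sumFin-fireAt v κ) (sym total) (sumFin-mono (fireAt-≤v v κ≤κ' κv<κ'v)))))
    ...   | suc gap with go gap (reach-fire v r F) (fireAt-≤v v κ≤κ' κv<κ'v)
                          (trans (cong (_+ gap) (sumFin-fireAt v κ)) (trans (+-assoc (sumFin κ) 1 gap) total))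
    ...     | vs , legal , run≗κ' = v ∷ vs , (F , legal) , run≗κ'

  private
    module ≈M = IsEquivalence MSame-isEquivalence

  CanFire-transport : ∀ {κ κ'} v → Reach κ → Reach κ' → MSame m (state κ) (state κ') →
                      CanFire κ v → CanFire κ' v
  CanFire-transport {κ} {κ'} v r r' same F =
    MFirable⇒CanFire {κ'} v (Reach⇒Solvent r') (MFirable-resp v same (CanFire⇒MFirable {κ} v F))

  Legal-transport : ∀ {κ κ'} vs → Reach κ → Reach κ' → MSame m (state κ) (state κ') → Legal κ vs → Legal κ' vs
  Legal-transport []       r r' same _           = tt
  Legal-transport (v ∷ vs) r r' same (F , legal) =
    F' , Legal-transport vs (reach-fire v r F) (reach-fire v r' F') same⁺ legal
    where
    F' = CanFire-transport v r r' same F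
    same⁺ = ≈M.trans (≈M.sym (fireM-state v (Reach⇒Solvent r) F))
              (≈M.trans (fireM-resp v same) (fireM-state v (Reach⇒Solvent r') F'))

  record FiringSimulation (g : Game) : Set where
    open Game g
    field
      ≈-isEquivalence : IsEquivalence _≈_
      encode          : FiringVector → State
      encode-cong     : ∀ {κ κ'} → κ ≗ κ' → encode κ ≈ encode κ'
      init≈zeros      : init ≈ encode zeros
      step-sound      : ∀ {κ x y} → Reach κ → x ≈ encode κ → x ⟶ y →
                        ∃ λ v → CanFire κ v × y ≈ encode (fireAt v κ)
      step-complete   : ∀ {κ x} v → Reach κ → x ≈ encode κ → CanFire κ v →
                        ∃ λ y → x ⟶ y × y ≈ encode (fireAt v κ)

    private
      module ≈ = IsEquivalence ≈-isEquivalence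

    EncodeInjective : Set
    EncodeInjective = ∀ {κ κ'} → Reach κ → Reach κ' → encode κ ≈ encode κ' → κ ≗ κ'

    play-sound : ∀ {κ x z} → Reach κ → x ≈ encode κ → Star _⟶_ x z →
                 ∃ λ μ → Reach μ × z ≈ encode μ × κ ≤v μ
    play-sound r x≈ ε = _ , r , x≈ , λ _ → ≤-refl
    play-sound {κ} r x≈ (step ◅ steps) with step-sound r x≈ step
    ... | v , F , y≈ with play-sound (reach-fire v r F) y≈ steps
    ... | μ , rμ , z≈ , κ⁺≤μ = μ , rμ , z≈ , λ w → ≤-trans (≤v-fireAt v κ w) (κ⁺≤μ w)

    play-complete : ∀ {κ x} vs → Reach κ → x ≈ encode κ → Legal κ vs →
                    ∃ λ z → Star _⟶_ x z × z ≈ encode (run κ vs)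
    play-complete []       r x≈ _           = _ , ε , x≈
    play-complete (v ∷ vs) r x≈ (F , legal) with step-complete v r x≈ F
    ... | y , step , y≈ with play-complete vs (reach-fire v r F) y≈ legal
    ... | z , steps , z≈ = z , step ◅ steps , z≈

    Reachable⇒encoded : ∀ {x} → Reachable g x → ∃ λ κ → Reach κ × x ≈ encode κ
    Reachable⇒encoded (z , steps , z≈x) with play-sound reach-zeros init≈zeros steps
    ... | κ , r , z≈ , _ = κ , r , ≈.trans (≈.sym z≈x) z≈

    Reach⇒Reachable : ∀ {κ} → Reach κ → Reachable g (encode κ)
    Reach⇒Reachable r with legal-run-between reach-zeros r (λ _ → z≤n)
    ... | vs , legal , run≗κ with play-complete vs reach-zeros init≈zeros legal
    ... | z , steps , z≈ = z , steps , ≈.trans z≈ (encode-cong run≗κ)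

    ⊑⇔≤v : EncodeInjective → ∀ {κ κ' x y} → Reach κ → Reach κ' → x ≈ encode κ → y ≈ encode κ' →
           _⊑_ g x y ⇔ κ ≤v κ'
    ⊑⇔≤v injective {κ} {κ'} {x} {y} r r' x≈ y≈ = mk⇔ to from
      where
      to : _⊑_ g x y → κ ≤v κ'
      to (z , steps , z≈y) with play-sound r x≈ steps
      ... | μ , rμ , z≈μ , κ≤μ =
        λ w → ≤-trans (κ≤μ w) (≤-reflexive (injective rμ r' (≈.trans (≈.sym z≈μ) (≈.trans z≈y y≈)) w))
      from : κ ≤v κ' → _⊑_ g x y
      from κ≤κ' with legal-run-between r r' κ≤κ'
      ... | vs , legal , run≗κ' with play-complete vs r x≈ legal
      ... | z , steps , z≈ = z , steps , ≈.trans z≈ (≈.trans (encode-cong run≗κ') (≈.sym y≈))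

    ≈⇔≗ : EncodeInjective → ∀ {κ κ' x y} → Reach κ → Reach κ' → x ≈ encode κ → y ≈ encode κ' →
          x ≈ y ⇔ κ ≗ κ'
    ≈⇔≗ injective r r' x≈ y≈ = mk⇔
      (λ x≈y → injective r r' (≈.trans (≈.sym x≈) (≈.trans x≈y y≈)))
      (λ κ≗κ' → ≈.trans x≈ (≈.trans (encode-cong κ≗κ') (≈.sym y≈)))

    terminal⇒stable : ∀ {κ x} → Reach κ → x ≈ encode κ → (∀ y → ¬ (x ⟶ y)) → ∀ v → ¬ CanFire κ v
    terminal⇒stable r x≈ terminal v F = terminal _ (proj₁ (proj₂ (step-complete v r x≈ F)))

    stable⇒terminal : ∀ {κ} → Reach κ → (∀ v → ¬ CanFire κ v) → ∀ y → ¬ (encode κ ⟶ y)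
    stable⇒terminal r stable y step = stable _ (proj₁ (proj₂ (step-sound r ≈.refl step)))

  simulations-iso : ∀ {g h} (S : FiringSimulation g) (T : FiringSimulation h) →
                    FiringSimulation.EncodeInjective S → FiringSimulation.EncodeInjective T →
                    ConfigSpaceIso g h
  simulations-iso {g} {h} S T injS injT = record
    { f       = λ x p → T.encode (vector p)
    ; f-reach = λ x p → T.Reach⇒Reachable (vector-reach p)
    ; f-eq    = f-eq
    ; f-surj  = f-surj
    ; f-order = f-order
    }
    where
    module S = FiringSimulation S
    module T = FiringSimulation T
    module ≈S = IsEquivalence S.≈-isEquivalence
    module ≈T = IsEquivalence T.≈-isEquivalence
    module ⇔ = IsEquivalence ⇔-isEquivalence
    open Game g using () renaming (_≈_ to _≈g_)
    open Game h using () renaming (_≈_ to _≈h_)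

    vector : ∀ {x} → Reachable g x → FiringVector
    vector p = proj₁ (S.Reachable⇒encoded p)

    vector-reach : ∀ {x} (p : Reachable g x) → Reach (vector p)
    vector-reach p = proj₁ (proj₂ (S.Reachable⇒encoded p))

    ≈vector : ∀ {x} (p : Reachable g x) → x ≈g S.encode (vector p)
    ≈vector p = proj₂ (proj₂ (S.Reachable⇒encoded p))

    f-eq : ∀ x p y q → x ≈g y ⇔ T.encode (vector p) ≈h T.encode (vector q)
    f-eq x p y q = ⇔.trans (S.≈⇔≗ injS (vector-reach p) (vector-reach q) (≈vector p) (≈vector q))
                           (⇔.sym (T.≈⇔≗ injT (vector-reach p) (vector-reach q) ≈T.refl ≈T.refl))

    f-surj : ∀ y → Reachable h y → ∃ λ x → Σ (Reachable g x) λ p → T.encode (vector p) ≈h y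
    f-surj y q with T.Reachable⇒encoded q
    ... | κ , r , y≈ = S.encode κ , p , ≈T.trans (T.encode-cong vector≗κ) (≈T.sym y≈)
      where
      p = S.Reach⇒Reachable r
      vector≗κ = injS (vector-reach p) r (≈S.sym (≈vector p))

    f-order : ∀ x p y q → _⊑_ g x y ⇔ _⊑_ h (T.encode (vector p)) (T.encode (vector q))
    f-order x p y q = ⇔.trans (S.⊑⇔≤v injS (vector-reach p) (vector-reach q) (≈vector p) (≈vector q))
                              (⇔.sym (T.⊑⇔≤v injT (vector-reach p) (vector-reach q) ≈T.refl ≈T.refl))

  mcfgSimulation : FiringSimulation (mcfgGame m)
  mcfgSimulation = record
    { ≈-isEquivalence = MSame-isEquivalence
    ; encode          = state
    ; encode-cong     = state-cong
    ; init≈zeros      = (λ u → sym (inflow-zeros u)) , (λ _ _ → refl) , (λ _ _ _ → refl)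
    ; step-sound      = step-sound
    ; step-complete   = step-complete
    }
    where
    step-sound : ∀ {κ x y} → Reach κ → MSame m x (state κ) → MCFGStep m x y →
                 ∃ λ v → CanFire κ v × MSame m y (state (fireAt v κ))
    step-sound {κ} r x≈ (v , firable , y≈) =
      v , F , ≈M.trans y≈ (≈M.trans (fireM-resp v x≈) (fireM-state v (Reach⇒Solvent r) F))
      where F = MFirable⇒CanFire {κ} v (Reach⇒Solvent r) (MFirable-resp v x≈ firable)

    step-complete : ∀ {κ x} v → Reach κ → MSame m x (state κ) → CanFire κ v →
                    ∃ λ y → MCFGStep m x y × MSame m y (state (fireAt v κ))
    step-complete {κ} {x} v r x≈ F =
      fireM m v x ,
      (v , MFirable-resp v (≈M.sym x≈) (CanFire⇒MFirable {κ} v F) , ≈M.refl) ,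
      ≈M.trans (fireM-resp v x≈) (fireM-state v (Reach⇒Solvent r) F)

  module _ {N} (N-reach : Reach N) (N-stable : ∀ v → ¬ CanFire N v) where

    Reach⇒≤N : ∀ {κ} → Reach κ → κ ≤v N
    Reach⇒≤N {κ} r with Reach⇒≤v⊎CanFire r N
    ... | inj₁ κ≤N         = κ≤N
    ... | inj₂ (v , _ , F) = ⊥-elim (N-stable v F)

    -- Replaying from κ' the run that leads from κ to N stays below N.
    state-reflects-≤v : ∀ {κ κ'} → Reach κ → Reach κ' → MSame m (state κ) (state κ') → κ' ≤v κ
    state-reflects-≤v {κ} {κ'} r r' same with legal-run-between r N-reach (Reach⇒≤N r)
    ... | vs , legal , run≗N = run-reflects-≤v vs λ w →
      subst (run κ' vs w ≤_) (sym (run≗N w)) (Reach⇒≤N (Legal⇒Reach vs r' (Legal-transport vs r r' same legal)) w)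

    state-injective : FiringSimulation.EncodeInjective mcfgSimulation
    state-injective r r' same w = ≤-antisym (state-reflects-≤v r' r (≈M.sym same) w) (state-reflects-≤v r r' same w)

module SimulatingCFG (m : MCFG) {N : FiringVectors.FiringVector m}
                     (N-reach : FiringVectors.Reach m N) (N-stable : ∀ v → ¬ FiringVectors.CanFire m N v) where
  open MCFG m
  open FiringVectors m

  B : ℕ
  B = sumFin N

  -- chain u j performs the (j+1)-th firing of u; B bounds every N u and only the levels
  -- j < N u have out-edges.  counter u counts the firings of u, and the sink absorbs
  -- bonuses and spent chips.
  data Vertex : Set where
    sink    : Vertex
    counter : Fin n → Vertex
    chain   : Fin n → Fin B → Vertex

  size : ℕ
  size = suc (n * suc B)

  pairVertex : Fin n × Fin (suc B) → Vertex
  pairVertex (u , zero)  = counter u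
  pairVertex (u , suc j) = chain u j

  vertex : Fin size → Vertex
  vertex zero    = sink
  vertex (suc y) = pairVertex (remQuot (suc B) y)

  index : Vertex → Fin size
  index sink        = zero
  index (counter u) = suc (combine u zero)
  index (chain u j) = suc (combine u (suc j))

  vertex-index : ∀ k → vertex (index k) ≡ k
  vertex-index sink        = refl
  vertex-index (counter u) = cong pairVertex (Fin.remQuot-combine u zero)
  vertex-index (chain u j) = cong pairVertex (Fin.remQuot-combine u (suc j))

  index-vertex : ∀ x → index (vertex x) ≡ x
  index-vertex zero    = refl
  index-vertex (suc y) = trans (index-pair (remQuot (suc B) y)) (cong suc (Fin.combine-remQuot {n} (suc B) y))
    where
    index-pair : ∀ p → index (pairVertex p) ≡ suc (combine (proj₁ p) (proj₂ p))
    index-pair (u , zero)  = refl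
    index-pair (u , suc j) = refl

  vertex-injective : ∀ {x y} → vertex x ≡ vertex y → x ≡ y
  vertex-injective {x} {y} eq = trans (sym (index-vertex x)) (trans (cong index eq) (index-vertex y))

  -- Exceeds every reachable inflow, so a chain vertex can only fire while holding the bonus.
  bonus : Fin n → ℕ
  bonus u = suc (inflow N u)

  handover : Fin n → ℕ → Fin n → Fin B → ℕ
  handover u c u' j' = if ⌊ u ≟ u' ⌋ then (if ⌊ toℕ j' ℕ.≟ suc c ⌋ then bonus u else 0) else 0

  chainEdges : Fin n → ℕ → Vertex → ℕ
  chainEdges u c sink          = bonus u + spent u (suc c)
  chainEdges u c (counter u')  = if ⌊ u ≟ u' ⌋ then 1 else 0
  chainEdges u c (chain u' j') = edges u c u' + handover u c u' j'

  out : Vertex → Vertex → ℕ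
  out (chain u j) k = if ⌊ toℕ j <? N u ⌋ then chainEdges u (toℕ j) k else 0
  out _           k = 0

  graph : Graph size
  graph x y = out (vertex x) (vertex y)

  padding : Vertex → ℕ
  padding k = sumFin (λ y → out k (vertex (suc y)))

  absorbed : Fin n → ℕ → ℕ
  absorbed u zero    = 0
  absorbed u (suc c) = absorbed u c + (bonus u + spent u (suc c))

  module Chain (u : Fin n) (j : Fin B) = ChainVertex (toℕ j) (padding (chain u j)) (bonus u) (spent u (suc (toℕ j)))

  chips : FiringVector → Vertex → ℕ
  chips κ sink        = sumFin (λ u → absorbed u (κ u))
  chips κ (counter u) = κ u
  chips κ (chain u j) = Chain.chips u j (κ u) (inflow κ u)

  configuration : FiringVector → Config size
  configuration κ x = chips κ (vertex x)

  simulatingCFG : CFG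
  simulatingCFG = record { n = size ; G = graph ; σ₀ = configuration zeros }

  out-active : ∀ {u j} k → toℕ j < N u → out (chain u j) k ≡ chainEdges u (toℕ j) k
  out-active {u} {j} k active with toℕ j <? N u
  ... | yes _        = refl
  ... | no inactive = ⊥-elim (inactive active)

  out-inactive : ∀ {u j} k → ¬ toℕ j < N u → out (chain u j) k ≡ 0
  out-inactive {u} {j} k inactive with toℕ j <? N u
  ... | yes active = ⊥-elim (inactive active)
  ... | no _       = refl

  handover-not-next : ∀ u c u' j' → toℕ j' ≢ suc c → handover u c u' j' ≡ 0
  handover-not-next u c u' j' j'≢1+c with u ≟ u' | toℕ j' ℕ.≟ suc c
  ... | yes _ | yes j'≡ = ⊥-elim (j'≢1+c j'≡)
  ... | yes _ | no _    = refl
  ... | no _  | _       = refl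

  FirableVertex : FiringVector → Vertex → Set
  FirableVertex κ k = 1 ≤ out k sink + padding k × out k sink + padding k ≤ chips κ k

  silent-unfirable : ∀ κ k → (∀ w → out k w ≡ 0) → ¬ FirableVertex κ k
  silent-unfirable κ k silent (positive , _) =
    n≮0 (subst (1 ≤_) (cong₂ _+_ (silent sink) (sumFin-zero (λ y → silent (vertex (suc y))))) positive)

  fired-level-paid : ∀ {κ} → Reach κ → ∀ {u} c → c < κ u → spent u (suc c) ≤ inflow κ u
  fired-level-paid r {u} c c<κu = ≤-trans (prefixSum-mono (degree u) c<κu) (Reach⇒Solvent r u)

  inflow<bonus : ∀ {κ} → Reach κ → ∀ u → inflow κ u < bonus u
  inflow<bonus r u = s≤s (inflow-mono u (Reach⇒≤N N-reach N-stable r))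

  record NextFiring (κ : FiringVector) (u : Fin n) (x : Fin size) : Set where
    field
      j        : Fin B
      is-chain : vertex x ≡ chain u j
      active   : toℕ j < N u
      at-level : κ u ≡ toℕ j
      paid     : spent u (suc (toℕ j)) ≤ inflow κ u

  CanFire⇒NextFiring : ∀ {κ u} → Reach κ → CanFire κ u → ∃ λ x → NextFiring κ u x
  CanFire⇒NextFiring {κ} {u} r F@(_ , paid) = index (chain u j) , record
    { j = j ; is-chain = vertex-index (chain u j) ; active = subst (_< N u) (sym j≡κu) κu<Nu
    ; at-level = sym j≡κu ; paid = subst (λ c → spent u (suc c) ≤ inflow κ u) (sym j≡κu) paid }
    where
    κu<Nu : κ u < N u
    κu<Nu = subst (_≤ N u) (fireAt-self u κ) (Reach⇒≤N N-reach N-stable (reach-fire u r F) u)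
    κu<B : κ u < B
    κu<B = <-≤-trans κu<Nu (≤-sumFin N u)
    j : Fin B
    j = fromℕ< κu<B
    j≡κu : toℕ j ≡ κ u
    j≡κu = Fin.toℕ-fromℕ< κu<B

  NextFiring⇒CanFire : ∀ {κ u x} → NextFiring κ u x → CanFire κ u
  NextFiring⇒CanFire {κ} {u} t =
    Reach⇒degree-positive N-reach u (subst (_< N u) (sym at-level) active) ,
    subst (λ c → spent u (suc c) ≤ inflow κ u) (sym at-level) paid
    where open NextFiring t

  NextFiring⇒Firable : ∀ {κ u x} → NextFiring κ u x → Firable (graph x) (configuration κ) x
  NextFiring⇒Firable {κ} {u} t = subst (FirableVertex κ) (sym is-chain) (positive , enough)
    where
    open NextFiring t
    outdeg≡ : out (chain u j) sink + padding (chain u j) ≡ Chain.outdegree u j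
    outdeg≡ = cong (_+ padding (chain u j)) (out-active sink active)
    positive : 1 ≤ out (chain u j) sink + padding (chain u j)
    positive = subst (1 ≤_) (sym outdeg≡) (s≤s z≤n)
    enough : out (chain u j) sink + padding (chain u j) ≤ chips κ (chain u j)
    enough = subst (_≤ chips κ (chain u j)) (sym outdeg≡)
               (Chain.firable-at-level u j at-level paid)

  Firable⇒NextFiring : ∀ {κ} → Reach κ → ∀ x → Firable (graph x) (configuration κ) x →
                       ∃ λ u → NextFiring κ u x
  Firable⇒NextFiring {κ} r x = by-vertex (vertex x) refl
    where
    by-vertex : ∀ k → vertex x ≡ k → FirableVertex κ k → ∃ λ u → NextFiring κ u x
    by-vertex sink        _ firable = ⊥-elim (silent-unfirable κ sink (λ _ → refl) firable)
    by-vertex (counter u) _ firable = ⊥-elim (silent-unfirable κ (counter u) (λ _ → refl) firable)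
    by-vertex (chain u j) is-chain firable = by-activity (toℕ j <? N u)
      where
      by-activity : Dec (toℕ j < N u) → ∃ λ u → NextFiring κ u x
      by-activity (no inactive) = ⊥-elim (silent-unfirable κ (chain u j) (λ w → out-inactive w inactive) firable)
      by-activity (yes active)  = u , record { j = j ; is-chain = is-chain ; active = active
                                             ; at-level = at-level ; paid = paid }
        where
        fires : Chain.outdegree u j ≤ Chain.chips u j (κ u) (inflow κ u)
        fires = subst (_≤ chips κ (chain u j)) (cong (_+ padding (chain u j)) (out-active sink active)) (proj₂ firable)
        at-level = proj₁ (Chain.firable⇒at-level u j (κ u) (inflow<bonus r u) fires)
        paid     = proj₂ (Chain.firable⇒at-level u j (κ u) (inflow<bonus r u) fires)

  module _ {κ u x} (r : Reach κ) (t : NextFiring κ u x) where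
    open NextFiring t

    private
      κ⁺ : FiringVector
      κ⁺ = fireAt u κ

      edges-at-level : ∀ k → out (chain u j) k ≡ chainEdges u (κ u) k
      edges-at-level k = trans (out-active k active) (cong (λ c → chainEdges u c k) (sym at-level))

      j≢1+κu : toℕ j ≢ suc (κ u)
      j≢1+κu j≡1+κu = 1+n≢n (sym (trans j≡1+κu (cong suc at-level)))

    receive-chain : ∀ u' j' → chain u' j' ≢ chain u j →
                    Chain.chips u' j' (κ u') (inflow κ u') + chainEdges u (κ u) (chain u' j')
                      ≡ Chain.chips u' j' (κ⁺ u') (inflow κ u' + edges u (κ u) u')
    receive-chain u' j' not-self with u ≟ u'
    ... | no u≢u' = trans (cong (Chain.chips u' j' (κ u') (inflow κ u') +_) (+-identityʳ _))
                          (Chain.chips-receive u' j' _ (fired-level-paid r (toℕ j')))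
    ... | yes refl with toℕ j' ℕ.≟ suc (κ u)
    ...   | yes j'≡1+κu = Chain.chips-handover u j' _ (sym j'≡1+κu)
    ...   | no j'≢1+κu  = begin
      Chain.chips u j' (κ u) (inflow κ u) + (e + 0)   ≡⟨ cong (Chain.chips u j' (κ u) (inflow κ u) +_) (+-identityʳ e) ⟩
      Chain.chips u j' (κ u) (inflow κ u) + e         ≡⟨ Chain.chips-receive u j' e (fired-level-paid r (toℕ j')) ⟩
      Chain.chips u j' (κ u) (inflow κ u + e)         ≡⟨ Chain.chips-skip u j' κu≢j' (j'≢1+κu ∘ sym) ⟨
      Chain.chips u j' (suc (κ u)) (inflow κ u + e)   ∎
      where
      open ≡-Reasoning
      e = edges u (κ u) u
      κu≢j' : κ u ≢ toℕ j'
      κu≢j' κu≡j' = not-self (cong (chain u) (Fin.toℕ-injective (trans (sym κu≡j') at-level)))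

    receive : ∀ k → k ≢ chain u j → chips κ k + out (chain u j) k ≡ chips κ⁺ k
    receive sink _ = trans (cong (chips κ sink +_) (edges-at-level sink))
      (sym (sumFin-increase u _ (λ w u≢w → cong (absorbed w) (fireAt-other κ u≢w))
                                (cong (absorbed u) (fireAt-self u κ))))
    receive (counter u') _ rewrite edges-at-level (counter u') with u ≟ u'
    ... | yes refl = +-comm (κ u) 1
    ... | no _     = +-identityʳ (κ u')
    receive (chain u' j') not-self = begin
      chips κ (chain u' j') + out (chain u j) (chain u' j')
        ≡⟨ cong (chips κ (chain u' j') +_) (edges-at-level (chain u' j')) ⟩
      Chain.chips u' j' (κ u') (inflow κ u') + chainEdges u (κ u) (chain u' j')
        ≡⟨ receive-chain u' j' not-self ⟩
      Chain.chips u' j' (κ⁺ u') (inflow κ u' + edges u (κ u) u')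
        ≡⟨ cong (Chain.chips u' j' (κ⁺ u')) (inflow-fireAt u κ u') ⟨
      chips κ⁺ (chain u' j')
        ∎
      where open ≡-Reasoning

    emit : (chips κ (chain u j) ∸ (out (chain u j) sink + padding (chain u j))) + out (chain u j) (chain u j)
             ≡ chips κ⁺ (chain u j)
    emit = begin
      (chips κ (chain u j) ∸ (out (chain u j) sink + padding (chain u j))) + out (chain u j) (chain u j)
        ≡⟨ cong₂ (λ d e → (chips κ (chain u j) ∸ (d + padding (chain u j))) + e) (out-active sink active) self-edge ⟩
      (Chain.chips u j (κ u) (inflow κ u) ∸ Chain.outdegree u j) + edges u (κ u) u
        ≡⟨ Chain.chips-fire u j _ at-level paid ⟩
      Chain.chips u j (suc (κ u)) (inflow κ u + edges u (κ u) u)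
        ≡⟨ cong₂ (Chain.chips u j) (fireAt-self u κ) (inflow-fireAt u κ u) ⟨
      chips κ⁺ (chain u j)
        ∎
      where
      open ≡-Reasoning
      self-edge : out (chain u j) (chain u j) ≡ edges u (κ u) u
      self-edge = trans (edges-at-level (chain u j))
                    (trans (cong (edges u (κ u) u +_) (handover-not-next u (κ u) u j j≢1+κu)) (+-identityʳ _))

    fire-next : fire (graph x) x (configuration κ) ≗ configuration (fireAt u κ)
    fire-next w = by-target (x ≟ w)
      where
      by-target : Dec (x ≡ w) → fire (graph x) x (configuration κ) w ≡ configuration κ⁺ w
      by-target (yes refl) = trans (fire-self (graph x) x (configuration κ))
        (subst (λ k → (chips κ k ∸ (out k sink + padding k)) + out k k ≡ chips κ⁺ k) (sym is-chain) emit)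
      by-target (no x≢w) = trans (fire-other (graph x) (configuration κ) x≢w)
        (subst (λ k → chips κ (vertex w) + out k (vertex w) ≡ chips κ⁺ (vertex w)) (sym is-chain)
          (receive (vertex w) (λ w-is-chain → x≢w (vertex-injective (trans is-chain (sym w-is-chain))))))

  configuration-cong : ∀ {κ κ'} → κ ≗ κ' → configuration κ ≗ configuration κ'
  configuration-cong {κ} {κ'} κ≗κ' x = chips-cong (vertex x)
    where
    chips-cong : ∀ k → chips κ k ≡ chips κ' k
    chips-cong sink        = sumFin-cong (λ u → cong (absorbed u) (κ≗κ' u))
    chips-cong (counter u) = κ≗κ' u
    chips-cong (chain u j) = cong₂ (Chain.chips u j) (κ≗κ' u) (inflow-cong u κ≗κ')

  configuration-injective : ∀ {κ κ'} → configuration κ ≗ configuration κ' → κ ≗ κ'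
  configuration-injective {κ} {κ'} same u =
    subst (λ k → chips κ k ≡ chips κ' k) (vertex-index (counter u)) (same (index (counter u)))

  cfgSimulation : FiringSimulation (cfgGame simulatingCFG)
  cfgSimulation = record
    { ≈-isEquivalence = Setoid.isEquivalence (Fin size →-setoid ℕ)
    ; encode          = configuration
    ; encode-cong     = configuration-cong
    ; init≈zeros      = λ _ → refl
    ; step-sound      = step-sound
    ; step-complete   = step-complete
    }
    where
    step-sound : ∀ {κ σ σ'} → Reach κ → σ ≗ configuration κ → CFGStep simulatingCFG σ σ' →
                 ∃ λ v → CanFire κ v × σ' ≗ configuration (fireAt v κ)
    step-sound r σ≈ (x , firable , σ'≈) with Firable⇒NextFiring r x (Firable-resp {E = graph x} σ≈ firable)
    ... | u , t = u , NextFiring⇒CanFire t ,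
                  λ w → trans (σ'≈ w) (trans (fire-cong {E = graph x} x (λ _ → refl) σ≈ w) (fire-next r t w))

    step-complete : ∀ {κ σ} v → Reach κ → σ ≗ configuration κ → CanFire κ v →
                    ∃ λ σ' → CFGStep simulatingCFG σ σ' × σ' ≗ configuration (fireAt v κ)
    step-complete {σ = σ} v r σ≈ F with CanFire⇒NextFiring r F
    ... | x , t = fire (graph x) x σ ,
                  (x , Firable-resp {E = graph x} (sym ∘ σ≈) (NextFiring⇒Firable t) , λ _ → refl) ,
                  λ w → trans (fire-cong {E = graph x} x (λ _ → refl) σ≈ w) (fire-next r t w)

  simulatingCFG-convergent : CFGConvergent simulatingCFG
  simulatingCFG-convergent =
    configuration N , Reach⇒Reachable N-reach ,
    λ x firable → stable⇒terminal N-reach N-stable _ (x , firable , λ _ → refl)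
    where open FiringSimulation cfgSimulation

  simulatingCFG-iso : ConfigSpaceIso (mcfgGame m) (cfgGame simulatingCFG)
  simulatingCFG-iso = simulations-iso mcfgSimulation cfgSimulation
                        (state-injective N-reach N-stable) (λ _ _ → configuration-injective)

theorem3 : (m : MCFG) → MCFGConvergent m →
    Σ CFG (λ c → CFGConvergent c × ConfigSpaceIso (mcfgGame m) (cfgGame c))
theorem3 m (s , s-reachable , s-final) with Reachable⇒encoded s-reachable
  where open FiringVectors.FiringSimulation (FiringVectors.mcfgSimulation m)
... | N , N-reach , s≈N = simulatingCFG , simulatingCFG-convergent , simulatingCFG-iso
  where
  open FiringVectors m
  N-stable : ∀ v → ¬ CanFire N v
  N-stable = FiringSimulation.terminal⇒stable mcfgSimulation N-reach s≈N (λ _ (v , firable , _) → s-final v firable)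
  open SimulatingCFG m N-reach N-stable
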